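{- Let $\mathcal{P}=\{2413, 2431, 4213, 3412, 3421, 4231, 4321, 4312\}$, let $I_k=12\cdots k$, and let $n\geq 4$. There are exactly 4 skew sum decomposable $n$-permutations avoiding $\mathcal{P}$, namely $21[1,I_{n-1}]$, $312[1,I_{n-3},21]$, $21[I_{n-1},1]$ and $231[21,I_{n-3},1]$.
   Context: For a $k$-permutation $\sigma$ and permutations $\alpha^{(1)},\dots,\alpha^{(k)}$, the inflation $\sigma[\alpha^{(1)},\dots,\alpha^{(k)}]$ replaces each entry $\sigma_\ell$ by a block of consecutive positions order-isomorphic to $\alpha^{(\ell)}$ whose values form an interval, the blocks being ordered relative to each other as the entries of $\sigma$. A permutation is skew sum decomposable if it equals $21[\alpha,\beta]$ for nonempty $\alpha,\beta$. Pattern containment is the usual order-isomorphic subsequence containment. -}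

module Defs where

open import Data.Nat using (ℕ; zero; suc; _+_; _∸_; _<_; _<?_)
open import Data.Nat.ListAction using (sum)
open import Data.List using (List; []; _∷_; map; length; zip; filter; concatMap; upTo; _++_)
open import Data.List.Membership.Propositional using (_∈_)
open import Data.List.Relation.Binary.Sublist.Propositional using (_⊆_)
open import Data.List.Relation.Binary.Permutation.Propositional using (_↭_)
open import Data.List.Relation.Unary.All using (All)
open import Data.Product using (_×_; _,_; proj₁; proj₂; ∃; ∃-syntax)
open import Function.Bundles using (_⇔_)
open import Relation.Binary.PropositionalEquality using (_≡_)
open import Relation.Nullary using (¬_)

-- Permutations are written in one-line notation with values 0,…,n-1
-- (the paper's 1,…,n shifted down by one).
IsPerm : ℕ → List ℕ → Set
IsPerm n π = π ↭ upTo n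

OrderIso : List ℕ → List ℕ → Set
OrderIso a b =
  (length a ≡ length b) ×
  (∀ {p q} → p ∈ zip a b → q ∈ zip a b →
     (proj₁ p < proj₁ q) ⇔ (proj₂ p < proj₂ q))

Contains : List ℕ → List ℕ → Set
Contains π σ = ∃[ τ ] (τ ⊆ π × OrderIso τ σ)

Avoids : List ℕ → List ℕ → Set
Avoids π σ = ¬ Contains π σ

AvoidsAll : List ℕ → List (List ℕ) → Set
AvoidsAll π P = All (Avoids π) P

-- Inflation σ[α⁽¹⁾,…,α⁽ᵏ⁾]: block ℓ is α⁽ℓ⁾ shifted up by the total size of
-- the blocks α⁽ᵐ⁾ with σ_m < σ_ℓ.  (Used with length σ = number of blocks,
-- σ a permutation and every α a permutation.)
inflate : List ℕ → List (List ℕ) → List ℕ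
inflate σ αs = concatMap block ps
  where
  ps = zip σ αs
  offset : ℕ → ℕ
  offset s = sum (map (λ p → length (proj₂ p)) (filter (λ p → proj₁ p <? s) ps))
  block : ℕ × List ℕ → List ℕ
  block (s , α) = map (offset s +_) α

p1 p21 p231 p312 : List ℕ
p1 = 0 ∷ []
p21 = 1 ∷ 0 ∷ []
p231 = 1 ∷ 2 ∷ 0 ∷ []
p312 = 2 ∷ 0 ∷ 1 ∷ []

I : ℕ → List ℕ
I k = upTo k

NonEmpty : List ℕ → Set
NonEmpty xs = ¬ (xs ≡ [])

SkewDecomposable : List ℕ → Set
SkewDecomposable π =
  ∃[ α ] ∃[ β ] (IsPerm (length α) α × IsPerm (length β) β ×
                 NonEmpty α × NonEmpty β × π ≡ inflate p21 (α ∷ β ∷ []))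

𝒫 : List (List ℕ)
𝒫 = (1 ∷ 3 ∷ 0 ∷ 2 ∷ []) ∷ (1 ∷ 3 ∷ 2 ∷ 0 ∷ []) ∷ (3 ∷ 1 ∷ 0 ∷ 2 ∷ []) ∷
    (2 ∷ 3 ∷ 0 ∷ 1 ∷ []) ∷ (2 ∷ 3 ∷ 1 ∷ 0 ∷ []) ∷ (3 ∷ 1 ∷ 2 ∷ 0 ∷ []) ∷
    (3 ∷ 2 ∷ 1 ∷ 0 ∷ []) ∷ (3 ∷ 2 ∷ 0 ∷ 1 ∷ []) ∷ []

claimed : ℕ → List (List ℕ)
claimed n =
  inflate p21 (p1 ∷ I (n ∸ 1) ∷ []) ∷
  inflate p312 (p1 ∷ I (n ∸ 3) ∷ p21 ∷ []) ∷
  inflate p21 (I (n ∸ 1) ∷ p1 ∷ []) ∷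
  inflate p231 (p21 ∷ I (n ∸ 3) ∷ p1 ∷ []) ∷ []

-- In a skew sum α ⊖ β with |α|, |β| ≥ 2, the first two entries of α followed by the first two
-- entries of β form one of 3412, 3421, 4312, 4321 ∈ 𝒫, so α or β is the single point 1.
-- If α = 1, then π = n β, and π avoids 𝒫 exactly when every three-term subsequence of β starts
-- with its minimum (the patterns of 𝒫 beginning with 4 are 4213, 4231, 4312, 4321); such a
-- permutation of an interval is increasing or increasing with its last two entries swapped,
-- giving 21[1, I_{n-1}] and 312[1, I_{n-3}, 21]. Symmetrically, if β = 1 then every three-term
-- subsequence of α ends with its maximum, so α is increasing or increasing with its first two
-- entries swapped, giving 21[I_{n-1}, 1] and 231[21, I_{n-3}, 1].

module Submission where

open import Defs
open import Data.Nat using (ℕ; zero; suc; _+_; _≤_; _<_; z≤n; s≤s; z<s; s<s)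
open import Data.Nat.Properties
open import Data.List using (List; []; _∷_; map; length; zip; upTo; applyUpTo; _++_; [_])
open import Data.List.Properties using (map-id; map-cong; length-map; length-upTo; ++-identityʳ; reverse-++; ∷-injectiveˡ; ∷-injectiveʳ)
open import Data.List.Membership.Propositional using (_∈_)
open import Data.List.Relation.Unary.Any using (here; there)
open import Data.List.Relation.Unary.All as All using (All; []; _∷_)
open import Data.List.Relation.Unary.AllPairs as AllPairs using (AllPairs; []; _∷_)
open import Data.List.Relation.Unary.Unique.Propositional using (Unique)
open import Data.List.Relation.Binary.Sublist.Propositional using (_⊆_; []; _∷_; _∷ʳ_; to∈; from∈; minimum)
open import Data.List.Relation.Binary.Sublist.Propositional.Properties using (All-resp-⊆; ∷⁻; ∷ˡ⁻; ++⁺ˡ; ++⁺; reverse⁺; reverse⁻; length-mono-≤)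
open import Data.List.Relation.Binary.Permutation.Propositional using (_↭_; refl; prep; swap; trans; ↭-sym; ↭⇒↭ₛ′)
open import Data.List.Relation.Binary.Permutation.Propositional.Properties using (∈-resp-↭; drop-∷; ↭-length; ∷↭∷ʳ; ↭-empty-inv; ¬x∷xs↭[]; ↭-singleton-inv)
import Data.List.Relation.Binary.Permutation.Setoid.Properties as Permutationₛ
open import Data.Product using (_×_; _,_; proj₁; proj₂; ∃-syntax)
open import Data.Sum using (_⊎_; inj₁; inj₂)
open import Data.Empty using (⊥; ⊥-elim)
open import Function using (id)
open import Function.Bundles using (_⇔_; mk⇔; Equivalence)
open import Relation.Binary.Definitions using (Tri; tri<; tri≈; tri>)
open import Relation.Binary.PropositionalEquality as ≡ using (_≡_; _≢_; refl; sym; cong; cong₂; subst; subst₂; setoid; isEquivalence)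
open import Relation.Nullary using (¬_; contradiction)

_⊖_ : List ℕ → List ℕ → List ℕ
α ⊖ β = map (_+ length β) α ++ β

inflate-21 : ∀ α β → inflate p21 (α ∷ β ∷ []) ≡ α ⊖ β
inflate-21 α β = cong₂ _++_
  (map-cong (λ a → ≡.trans (cong (_+ a) (+-identityʳ (length β))) (+-comm (length β) a)) α)
  (≡.trans (++-identityʳ _) (map-id β))

range : ℕ → ℕ → List ℕ
range k zero = []
range k (suc m) = k ∷ range (suc k) m

upTo≡range : ∀ m → upTo m ≡ range 0 m
upTo≡range m = applyUpTo≡range id 0 m (λ _ → refl)
  where
  applyUpTo≡range : ∀ f k m → (∀ i → f i ≡ k + i) → applyUpTo f m ≡ range k m
  applyUpTo≡range f k zero _ = refl
  applyUpTo≡range f k (suc m) f≗k+ = cong₂ _∷_ (≡.trans (f≗k+ 0) (+-identityʳ k))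
    (applyUpTo≡range (λ i → f (suc i)) (suc k) m (λ i → ≡.trans (f≗k+ (suc i)) (+-suc k i)))

length-range : ∀ k m → length (range k m) ≡ m
length-range k zero = refl
length-range k (suc m) = cong suc (length-range (suc k) m)

map-+-range : ∀ c k m → map (_+ c) (range k m) ≡ range (k + c) m
map-+-range c k zero = refl
map-+-range c k (suc m) = cong (k + c ∷_) (map-+-range c (suc k) m)

map-+-upTo : ∀ c m → map (c +_) (upTo m) ≡ range c m
map-+-upTo c m =
  ≡.trans (map-cong (+-comm c) (upTo m)) (≡.trans (cong (map (_+ c)) (upTo≡range m)) (map-+-range c 0 m))

range-∷ʳ : ∀ k m → range k (suc m) ≡ range k m ++ [ k + m ]
range-∷ʳ k zero = cong [_] (sym (+-identityʳ k))
range-∷ʳ k (suc m) = cong (k ∷_) (≡.trans (range-∷ʳ (suc k) m) (cong (λ x → range (suc k) m ++ [ x ]) (sym (+-suc k m))))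

range-↭-max∷ : ∀ m → m ∷ range 0 m ↭ range 0 (suc m)
range-↭-max∷ m = subst (m ∷ range 0 m ↭_) (sym (range-∷ʳ 0 m)) (∷↭∷ʳ m (range 0 m))

∈-range⁻ : ∀ {x} k m → x ∈ range k m → k ≤ x × x < k + m
∈-range⁻ k (suc m) (here refl) = ≤-refl , subst (k <_) (sym (+-suc k m)) (s≤s (m≤m+n k m))
∈-range⁻ {x} k (suc m) (there x∈) with ∈-range⁻ (suc k) m x∈
... | k<x , x<1+k+m = <⇒≤ k<x , subst (x <_) (sym (+-suc k m)) x<1+k+m

range-increasing : ∀ k m → AllPairs _<_ (range k m)
range-increasing k zero = []
range-increasing k (suc m) = All.tabulate (λ x∈ → proj₁ (∈-range⁻ (suc k) m x∈)) ∷ range-increasing (suc k) m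

range-unique : ∀ k m → Unique (range k m)
range-unique k m = AllPairs.map <⇒≢ (range-increasing k m)

AllPairs-resp-⊇ : ∀ {A : Set} {R : A → A → Set} {xs ys} → xs ⊆ ys → AllPairs R ys → AllPairs R xs
AllPairs-resp-⊇ [] rs = rs
AllPairs-resp-⊇ (y ∷ʳ xs⊆) (_ ∷ rs) = AllPairs-resp-⊇ xs⊆ rs
AllPairs-resp-⊇ (refl ∷ xs⊆) (r ∷ rs) = All-resp-⊆ xs⊆ r ∷ AllPairs-resp-⊇ xs⊆ rs

⊆-dropLast : ∀ {A : Set} {xs ys : List A} {x y} → xs ++ [ x ] ⊆ ys ++ [ y ] → xs ⊆ ys
⊆-dropLast {xs = xs} {ys} {x} {y} p =
  reverse⁻ (∷⁻ (subst₂ _⊆_ (reverse-++ xs [ x ]) (reverse-++ ys [ y ]) (reverse⁺ p)))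

↭-unique : ∀ {xs ys : List ℕ} → xs ↭ ys → Unique xs → Unique ys
↭-unique p = Permutationₛ.Unique-resp-↭ (setoid ℕ) (↭⇒↭ₛ′ isEquivalence p)

↭-range⇒bounded : ∀ {xs k m} → xs ↭ range k m → All (λ x → k ≤ x × x < k + m) xs
↭-range⇒bounded {k = k} {m} p = All.tabulate (λ x∈ → ∈-range⁻ k m (∈-resp-↭ p x∈))

↭-range⇒unique : ∀ {xs k m} → xs ↭ range k m → Unique xs
↭-range⇒unique {k = k} {m} p = ↭-unique (↭-sym p) (range-unique k m)

↭-range-nonEmpty : ∀ {xs k m} → xs ↭ range k (suc m) → NonEmpty xs
↭-range-nonEmpty p refl = ¬x∷xs↭[] (↭-sym p)

↭-range-head : ∀ {x ys k m} → x ∷ ys ↭ range k (suc m) → All (x <_) ys → x ≡ k × ys ↭ range (suc k) m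
↭-range-head {k = k} {m} p x<ys with ∈-resp-↭ (↭-sym p) (here refl)
... | here refl = refl , drop-∷ p
... | there k∈ys = contradiction (proj₁ (∈-range⁻ k (suc m) (∈-resp-↭ p (here refl)))) (<⇒≱ (All.lookup x<ys k∈ys))

increasing-↭-range : ∀ m {xs k} → xs ↭ range k m → AllPairs _<_ xs → xs ≡ range k m
increasing-↭-range zero p _ = ↭-empty-inv p
increasing-↭-range (suc m) {[]} p _ = contradiction (↭-sym p) ¬x∷xs↭[]
increasing-↭-range (suc m) {x ∷ xs} p (x<xs ∷ xs↑) with ↭-range-head p x<xs
... | refl , p′ = cong (x ∷_) (increasing-↭-range m p′ xs↑)

rangeSwapFirst : ℕ → ℕ → List ℕ
rangeSwapFirst k j = suc k ∷ k ∷ range (2 + k) j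

rangeSwapLast : ℕ → ℕ → List ℕ
rangeSwapLast k zero = rangeSwapFirst k zero
rangeSwapLast k (suc j) = k ∷ rangeSwapLast (suc k) j

rangeSwapLast≡ : ∀ k j → rangeSwapLast k j ≡ range k j ++ k + suc j ∷ k + j ∷ []
rangeSwapLast≡ k zero = cong₂ (λ a b → a ∷ b ∷ []) (+-comm 1 k) (sym (+-identityʳ k))
rangeSwapLast≡ k (suc j) = cong (k ∷_) (≡.trans (rangeSwapLast≡ (suc k) j)
  (cong₂ (λ a b → range (suc k) j ++ a ∷ b ∷ []) (sym (+-suc k (suc j))) (sym (+-suc k j))))

rangeSwapFirst-↭ : ∀ k j → rangeSwapFirst k j ↭ range k (2 + j)
rangeSwapFirst-↭ k j = swap (suc k) k refl

rangeSwapLast-↭ : ∀ k j → rangeSwapLast k j ↭ range k (2 + j)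
rangeSwapLast-↭ k zero = rangeSwapFirst-↭ k zero
rangeSwapLast-↭ k (suc j) = prep k (rangeSwapLast-↭ (suc k) j)

range≢rangeSwapLast : ∀ k j → range k (2 + j) ≢ rangeSwapLast k j
range≢rangeSwapLast k zero eq = <-irrefl (∷-injectiveˡ eq) (n<1+n k)
range≢rangeSwapLast k (suc j) eq = range≢rangeSwapLast (suc k) j (∷-injectiveʳ eq)

↭-range-firstTwo : ∀ {a b rest k m} → a ∷ b ∷ rest ↭ range k (2 + m) →
  All (a <_) rest → All (b <_) rest → AllPairs _<_ rest →
  a ∷ b ∷ rest ≡ range k (2 + m) ⊎ a ∷ b ∷ rest ≡ rangeSwapFirst k m
↭-range-firstTwo {a} {b} {m = m} p a<rest b<rest rest↑ with <-cmp a b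
... | tri< a<b _ _ = inj₁ (increasing-↭-range (2 + m) p ((a<b ∷ a<rest) ∷ b<rest ∷ rest↑))
... | tri≈ _ a≡b _ = contradiction a≡b (All.head (AllPairs.head (↭-range⇒unique p)))
... | tri> _ _ b<a with increasing-↭-range (2 + m) (trans (swap b a refl) p) ((b<a ∷ b<rest) ∷ a<rest ∷ rest↑)
...   | refl = inj₂ refl

TriplesStartMinimal : List ℕ → Set
TriplesStartMinimal xs = ∀ {a b c} → a ∷ b ∷ c ∷ [] ⊆ xs → a < b × a < c

TriplesEndMaximal : List ℕ → Set
TriplesEndMaximal xs = ∀ {a b c} → a ∷ b ∷ c ∷ [] ⊆ xs → a < c × b < c

increasing-pair : ∀ {xs a b} → AllPairs _<_ xs → a ∷ b ∷ [] ⊆ xs → a < b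
increasing-pair xs↑ q with AllPairs-resp-⊇ q xs↑
... | (a<b ∷ []) ∷ _ = a<b

increasing⇒startMinimal : ∀ {xs} → AllPairs _<_ xs → TriplesStartMinimal xs
increasing⇒startMinimal xs↑ q with AllPairs-resp-⊇ q xs↑
... | (a<b ∷ a<c ∷ []) ∷ _ = a<b , a<c

increasing⇒endMaximal : ∀ {xs} → AllPairs _<_ xs → TriplesEndMaximal xs
increasing⇒endMaximal xs↑ q with AllPairs-resp-⊇ q xs↑
... | (_ ∷ a<c ∷ []) ∷ (b<c ∷ []) ∷ _ = a<c , b<c

startMinimal-∷ : ∀ {x xs} → All (x <_) xs → TriplesStartMinimal xs → TriplesStartMinimal (x ∷ xs)
startMinimal-∷ x<xs s (_ ∷ʳ q) = s q
startMinimal-∷ x<xs s (refl ∷ q) = All.lookup x<xs (to∈ q) , All.lookup x<xs (to∈ (∷ˡ⁻ q))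

endMaximal-∷∷ : ∀ {a b rest} → All (a <_) rest → All (b <_) rest → AllPairs _<_ rest →
  TriplesEndMaximal (a ∷ b ∷ rest)
endMaximal-∷∷ a<rest b<rest rest↑ (refl ∷ refl ∷ q) = All.lookup a<rest (to∈ q) , All.lookup b<rest (to∈ q)
endMaximal-∷∷ a<rest b<rest rest↑ (refl ∷ _ ∷ʳ q) = All.lookup a<rest (to∈ (∷ˡ⁻ q)) , increasing-pair rest↑ q
endMaximal-∷∷ a<rest b<rest rest↑ (_ ∷ʳ refl ∷ q) = All.lookup b<rest (to∈ (∷ˡ⁻ q)) , increasing-pair rest↑ q
endMaximal-∷∷ a<rest b<rest rest↑ (_ ∷ʳ _ ∷ʳ q) = increasing⇒endMaximal rest↑ q

rangeSwapLast-startMinimal : ∀ k j → TriplesStartMinimal (rangeSwapLast k j)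
rangeSwapLast-startMinimal k zero q = contradiction (length-mono-≤ q) λ { (s≤s (s≤s ())) }
rangeSwapLast-startMinimal k (suc j) =
  startMinimal-∷ (All.map proj₁ (↭-range⇒bounded (rangeSwapLast-↭ (suc k) j))) (rangeSwapLast-startMinimal (suc k) j)

rangeSwapFirst-endMaximal : ∀ k j → TriplesEndMaximal (rangeSwapFirst k j)
rangeSwapFirst-endMaximal k j =
  endMaximal-∷∷ (All.map proj₁ bounds) (All.map (λ b → <-trans (n<1+n k) (proj₁ b)) bounds) (range-increasing (2 + k) j)
  where
  bounds : All (λ x → 2 + k ≤ x × x < 2 + k + j) (range (2 + k) j)
  bounds = ↭-range⇒bounded refl

endMaximal⇒increasingTail : ∀ {a rest} → TriplesEndMaximal (a ∷ rest) → AllPairs _<_ rest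
endMaximal⇒increasingTail {rest = []} t = []
endMaximal⇒increasingTail {a} {x ∷ rest} t =
  All.tabulate (λ y∈ → proj₂ (t (refl ∷ refl ∷ from∈ y∈))) ∷ endMaximal⇒increasingTail (λ q → t (a ∷ʳ q))

startMinimal-↭-range : ∀ j {xs k} → xs ↭ range k (2 + j) → TriplesStartMinimal xs →
  xs ≡ range k (2 + j) ⊎ xs ≡ rangeSwapLast k j
-- The length equation lets the coverage checker discard all other shapes of xs.
startMinimal-↭-range j {xs} p s with ↭-length p
startMinimal-↭-range zero {a ∷ b ∷ []} p s | _ = ↭-range-firstTwo p [] [] []
startMinimal-↭-range (suc j) {x ∷ y ∷ z ∷ zs} p s | _ with ↭-range-head p x<rest
  where
  x<rest : All (x <_) (y ∷ z ∷ zs)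
  x<rest = proj₁ (s (refl ∷ refl ∷ refl ∷ minimum _)) ∷ All.tabulate (λ w∈ → proj₂ (s (refl ∷ refl ∷ from∈ w∈)))
... | refl , p′ with startMinimal-↭-range j p′ (λ q → s (x ∷ʳ q))
...   | inj₁ eq = inj₁ (cong (x ∷_) eq)
...   | inj₂ eq = inj₂ (cong (x ∷_) eq)

endMaximal-↭-range : ∀ j {xs k} → xs ↭ range k (2 + j) → TriplesEndMaximal xs →
  xs ≡ range k (2 + j) ⊎ xs ≡ rangeSwapFirst k j
endMaximal-↭-range j {xs} p t with ↭-length p
endMaximal-↭-range j {a ∷ b ∷ rest} p t | _ =
  ↭-range-firstTwo p (All.tabulate (λ y∈ → proj₁ (t (refl ∷ refl ∷ from∈ y∈))))
                     (All.tabulate (λ y∈ → proj₂ (t (refl ∷ refl ∷ from∈ y∈))))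
                     (endMaximal⇒increasingTail (λ q → t (a ∷ʳ q)))

∈-zip-map⁻ : ∀ (f : ℕ → ℕ) σ {p} → p ∈ zip (map f σ) σ → proj₁ p ≡ f (proj₂ p)
∈-zip-map⁻ f (s ∷ σ) (here refl) = refl
∈-zip-map⁻ f (s ∷ σ) (there p∈) = ∈-zip-map⁻ f σ p∈

strictlyIncreasing⇒OrderIso : ∀ (f : ℕ → ℕ) → (∀ {s t} → s < t → f s < f t) → ∀ σ → OrderIso (map f σ) σ
strictlyIncreasing⇒OrderIso f f-mono σ = length-map f σ , λ p∈ q∈ → iso (∈-zip-map⁻ f σ p∈) (∈-zip-map⁻ f σ q∈)
  where
  reflects : ∀ {s t} → f s < f t → s < t
  reflects {s} {t} fs<ft with <-cmp s t
  ... | tri< s<t _ _ = s<t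
  ... | tri≈ _ refl _ = contradiction fs<ft (<-irrefl refl)
  ... | tri> _ _ t<s = contradiction (f-mono t<s) (<-asym fs<ft)
  iso : ∀ {p q : ℕ × ℕ} → proj₁ p ≡ f (proj₂ p) → proj₁ q ≡ f (proj₂ q) → (proj₁ p < proj₁ q) ⇔ (proj₂ p < proj₂ q)
  iso refl refl = mk⇔ reflects f-mono

-- Sends the letter t of a pattern to w_t; continuing as t + w₃ beyond 3 keeps it strictly
-- increasing on all of ℕ, so no bound on the letters of the pattern is needed.
rankValue : ℕ → ℕ → ℕ → ℕ → ℕ → ℕ
rankValue w₀ w₁ w₂ w₃ 0 = w₀
rankValue w₀ w₁ w₂ w₃ 1 = w₁
rankValue w₀ w₁ w₂ w₃ 2 = w₂
rankValue w₀ w₁ w₂ w₃ (suc (suc (suc t))) = t + w₃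

rankValue-strictlyIncreasing : ∀ {w₀ w₁ w₂ w₃} → w₀ < w₁ → w₁ < w₂ → w₂ < w₃ →
  ∀ {s t} → s < t → rankValue w₀ w₁ w₂ w₃ s < rankValue w₀ w₁ w₂ w₃ t
rankValue-strictlyIncreasing {w₀} {w₁} {w₂} {w₃} w₀<w₁ w₁<w₂ w₂<w₃ = mono
  where
  f = rankValue w₀ w₁ w₂ w₃
  step : ∀ t → f t < f (suc t)
  step 0 = w₀<w₁
  step 1 = w₁<w₂
  step 2 = w₂<w₃
  step (suc (suc (suc t))) = n<1+n (t + w₃)
  mono : ∀ {s t} → s < t → f s < f t
  mono {s} {suc t} (s≤s s≤t) with m≤n⇒m<n∨m≡n s≤t
  ... | inj₁ s<t = <-trans (mono s<t) (step t)
  ... | inj₂ refl = step s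

contains-ranked : ∀ {π w₀ w₁ w₂ w₃} σ → w₀ < w₁ → w₁ < w₂ → w₂ < w₃ →
  map (rankValue w₀ w₁ w₂ w₃) σ ⊆ π → Contains π σ
contains-ranked σ w₀<w₁ w₁<w₂ w₂<w₃ σ⊆π =
  _ , σ⊆π , strictlyIncreasing⇒OrderIso _ (rankValue-strictlyIncreasing w₀<w₁ w₁<w₂ w₂<w₃) σ

orderIso-shape₄ : ∀ {τ s₀ s₁ s₂ s₃} → OrderIso τ (s₀ ∷ s₁ ∷ s₂ ∷ s₃ ∷ []) →
  ∃[ t₀ ] ∃[ t₁ ] ∃[ t₂ ] ∃[ t₃ ] τ ≡ t₀ ∷ t₁ ∷ t₂ ∷ t₃ ∷ []
orderIso-shape₄ {t₀ ∷ t₁ ∷ t₂ ∷ t₃ ∷ []} _ = t₀ , t₁ , t₂ , t₃ , refl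
orderIso-shape₄ {[]} (() , _)
orderIso-shape₄ {_ ∷ []} (() , _)
orderIso-shape₄ {_ ∷ _ ∷ []} (() , _)
orderIso-shape₄ {_ ∷ _ ∷ _ ∷ []} (() , _)
orderIso-shape₄ {_ ∷ _ ∷ _ ∷ _ ∷ _ ∷ _} (() , _)

startMinimal⇒avoids : ∀ {M β s₀ s₁ s₂ s₃} → TriplesStartMinimal β → s₂ < s₁ ⊎ s₃ < s₁ →
  Avoids (M ∷ β) (s₀ ∷ s₁ ∷ s₂ ∷ s₃ ∷ [])
startMinimal⇒avoids s shape (τ , τ⊆ , iso) with orderIso-shape₄ iso
... | _ , _ , _ , _ , refl with s (∷⁻ τ⊆) | shape
...   | t₁<t₂ , _ | inj₁ s₂<s₁ =
  <-asym t₁<t₂ (Equivalence.from (proj₂ iso (there (there (here refl))) (there (here refl))) s₂<s₁)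
...   | _ , t₁<t₃ | inj₂ s₃<s₁ =
  <-asym t₁<t₃ (Equivalence.from (proj₂ iso (there (there (there (here refl)))) (there (here refl))) s₃<s₁)

endMaximal⇒avoids : ∀ {α z s₀ s₁ s₂ s₃} → TriplesEndMaximal α → s₂ < s₀ ⊎ s₂ < s₁ →
  Avoids (α ++ [ z ]) (s₀ ∷ s₁ ∷ s₂ ∷ s₃ ∷ [])
endMaximal⇒avoids t shape (τ , τ⊆ , iso) with orderIso-shape₄ iso
... | t₀ , t₁ , t₂ , _ , refl with t (⊆-dropLast {xs = t₀ ∷ t₁ ∷ t₂ ∷ []} τ⊆) | shape
...   | t₀<t₂ , _ | inj₁ s₂<s₀ =
  <-asym t₀<t₂ (Equivalence.from (proj₂ iso (there (there (here refl))) (here refl)) s₂<s₀)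
...   | _ , t₁<t₂ | inj₂ s₂<s₁ =
  <-asym t₁<t₂ (Equivalence.from (proj₂ iso (there (there (here refl))) (there (here refl))) s₂<s₁)

startMinimal⇒avoids𝒫 : ∀ {M β} → TriplesStartMinimal β → AvoidsAll (M ∷ β) 𝒫
startMinimal⇒avoids𝒫 s =
  startMinimal⇒avoids s (inj₁ z<s) ∷ startMinimal⇒avoids s (inj₁ (s<s (s<s z<s))) ∷
  startMinimal⇒avoids s (inj₁ z<s) ∷ startMinimal⇒avoids s (inj₁ z<s) ∷
  startMinimal⇒avoids s (inj₁ (s<s z<s)) ∷ startMinimal⇒avoids s (inj₂ z<s) ∷
  startMinimal⇒avoids s (inj₁ (s<s z<s)) ∷ startMinimal⇒avoids s (inj₁ z<s) ∷ []

endMaximal⇒avoids𝒫 : ∀ {α z} → TriplesEndMaximal α → AvoidsAll (α ++ [ z ]) 𝒫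
endMaximal⇒avoids𝒫 t =
  endMaximal⇒avoids t (inj₁ z<s) ∷ endMaximal⇒avoids t (inj₂ (s<s (s<s z<s))) ∷
  endMaximal⇒avoids t (inj₁ z<s) ∷ endMaximal⇒avoids t (inj₁ z<s) ∷
  endMaximal⇒avoids t (inj₁ (s<s z<s)) ∷ endMaximal⇒avoids t (inj₁ (s<s (s<s z<s))) ∷
  endMaximal⇒avoids t (inj₁ (s<s z<s)) ∷ endMaximal⇒avoids t (inj₁ z<s) ∷ []

avoids𝒫⇒startMinimal : ∀ {M β} → All (_< M) β → Unique β → AvoidsAll (M ∷ β) 𝒫 → TriplesStartMinimal β
avoids𝒫⇒startMinimal β<M β! (_ ∷ _ ∷ ¬4213 ∷ _ ∷ _ ∷ ¬4231 ∷ ¬4321 ∷ ¬4312 ∷ []) {a} {b} {c} q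
  with All-resp-⊆ q β<M | AllPairs-resp-⊇ q β! | <-cmp a b | <-cmp a c
... | _ | _ | tri< a<b _ _ | tri< a<c _ _ = a<b , a<c
... | _ | (a≢b ∷ _) ∷ _ | tri≈ _ a≡b _ | _ = contradiction a≡b a≢b
... | _ | (_ ∷ a≢c ∷ _) ∷ _ | _ | tri≈ _ a≡c _ = contradiction a≡c a≢c
... | _ ∷ _ ∷ c<M ∷ [] | _ | tri> _ _ b<a | tri< a<c _ _ =
  contradiction (contains-ranked (3 ∷ 1 ∷ 0 ∷ 2 ∷ []) b<a a<c c<M (refl ∷ q)) ¬4213
... | _ ∷ b<M ∷ _ ∷ [] | _ | tri< a<b _ _ | tri> _ _ c<a =
  contradiction (contains-ranked (3 ∷ 1 ∷ 2 ∷ 0 ∷ []) c<a a<b b<M (refl ∷ q)) ¬4231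
... | a<M ∷ _ | _ ∷ (b≢c ∷ _) ∷ _ | tri> _ _ b<a | tri> _ _ c<a with <-cmp b c
...   | tri< b<c _ _ = contradiction (contains-ranked (3 ∷ 2 ∷ 0 ∷ 1 ∷ []) b<c c<a a<M (refl ∷ q)) ¬4312
...   | tri≈ _ b≡c _ = contradiction b≡c b≢c
...   | tri> _ _ c<b = contradiction (contains-ranked (3 ∷ 2 ∷ 1 ∷ 0 ∷ []) c<b b<a a<M (refl ∷ q)) ¬4321

avoids𝒫⇒endMaximal : ∀ {α z} → All (z <_) α → Unique α → AvoidsAll (α ++ [ z ]) 𝒫 → TriplesEndMaximal α
avoids𝒫⇒endMaximal z<α α! (_ ∷ ¬2431 ∷ _ ∷ _ ∷ ¬3421 ∷ ¬4231 ∷ ¬4321 ∷ _ ∷ []) {a} {b} {c} q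
  with All-resp-⊆ q z<α | AllPairs-resp-⊇ q α! | <-cmp a c | <-cmp b c
... | _ | _ | tri< a<c _ _ | tri< b<c _ _ = a<c , b<c
... | _ | (_ ∷ a≢c ∷ _) ∷ _ | tri≈ _ a≡c _ | _ = contradiction a≡c a≢c
... | _ | _ ∷ (b≢c ∷ _) ∷ _ | _ | tri≈ _ b≡c _ = contradiction b≡c b≢c
... | z<a ∷ _ | _ | tri< a<c _ _ | tri> _ _ c<b =
  contradiction (contains-ranked (1 ∷ 3 ∷ 2 ∷ 0 ∷ []) z<a a<c c<b (++⁺ q (refl ∷ []))) ¬2431
... | _ ∷ z<b ∷ _ | _ | tri> _ _ c<a | tri< b<c _ _ =
  contradiction (contains-ranked (3 ∷ 1 ∷ 2 ∷ 0 ∷ []) z<b b<c c<a (++⁺ q (refl ∷ []))) ¬4231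
... | _ ∷ _ ∷ z<c ∷ [] | (a≢b ∷ _) ∷ _ | tri> _ _ c<a | tri> _ _ c<b with <-cmp a b
...   | tri< a<b _ _ = contradiction (contains-ranked (2 ∷ 3 ∷ 1 ∷ 0 ∷ []) z<c c<a a<b (++⁺ q (refl ∷ []))) ¬3421
...   | tri≈ _ a≡b _ = contradiction a≡b a≢b
...   | tri> _ _ b<a = contradiction (contains-ranked (3 ∷ 2 ∷ 1 ∷ 0 ∷ []) z<c c<b b<a (++⁺ q (refl ∷ []))) ¬4321

¬avoids𝒫-⊖ : ∀ {x y as u v bs} → x ≢ y → u ≢ v → u < length (u ∷ v ∷ bs) → v < length (u ∷ v ∷ bs) →
  ¬ AvoidsAll ((x ∷ y ∷ as) ⊖ (u ∷ v ∷ bs)) 𝒫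
¬avoids𝒫-⊖ {x} {y} {as} {u} {v} {bs} x≢y u≢v u<K v<K (_ ∷ _ ∷ _ ∷ ¬3412 ∷ ¬3421 ∷ _ ∷ ¬4321 ∷ ¬4312 ∷ []) =
  cases (<-cmp x y) (<-cmp u v)
  where
  K = length (u ∷ v ∷ bs)
  occurrence : x + K ∷ y + K ∷ u ∷ v ∷ [] ⊆ (x ∷ y ∷ as) ⊖ (u ∷ v ∷ bs)
  occurrence = refl ∷ refl ∷ ++⁺ˡ (map (_+ K) as) (refl ∷ refl ∷ minimum bs)
  lift : ∀ {w} z → w < K → w < z + K
  lift z w<K = <-≤-trans w<K (m≤n+m K z)
  cases : Tri (x < y) (x ≡ y) (y < x) → Tri (u < v) (u ≡ v) (v < u) → ⊥
  cases (tri≈ _ x≡y _) _ = x≢y x≡y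
  cases _ (tri≈ _ u≡v _) = u≢v u≡v
  cases (tri< x<y _ _) (tri< u<v _ _) =
    ¬3412 (contains-ranked (2 ∷ 3 ∷ 0 ∷ 1 ∷ []) u<v (lift x v<K) (+-monoˡ-< K x<y) occurrence)
  cases (tri< x<y _ _) (tri> _ _ v<u) =
    ¬3421 (contains-ranked (2 ∷ 3 ∷ 1 ∷ 0 ∷ []) v<u (lift x u<K) (+-monoˡ-< K x<y) occurrence)
  cases (tri> _ _ y<x) (tri< u<v _ _) =
    ¬4312 (contains-ranked (3 ∷ 2 ∷ 0 ∷ 1 ∷ []) u<v (lift y v<K) (+-monoˡ-< K y<x) occurrence)
  cases (tri> _ _ y<x) (tri> _ _ v<u) =
    ¬4321 (contains-ranked (3 ∷ 2 ∷ 1 ∷ 0 ∷ []) v<u (lift y u<K) (+-monoˡ-< K y<x) occurrence)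

IsPerm⇒↭range : ∀ {m xs} → IsPerm m xs → xs ↭ range 0 m
IsPerm⇒↭range {m} p = subst (_ ↭_) (upTo≡range m) p

↭range⇒IsPerm : ∀ {m xs} → xs ↭ range 0 m → IsPerm m xs
↭range⇒IsPerm {m} {xs} p = subst (xs ↭_) (sym (upTo≡range m)) p

↭range⇒IsPerm-length : ∀ {m xs} → xs ↭ range 0 m → IsPerm (length xs) xs
↭range⇒IsPerm-length {m} {xs} p =
  subst (λ n → IsPerm n xs) (sym (≡.trans (↭-length p) (length-range 0 m))) (↭range⇒IsPerm p)

⊖-skewDecomposable : ∀ {α β} → IsPerm (length α) α → IsPerm (length β) β → NonEmpty α → NonEmpty β →
  SkewDecomposable (α ⊖ β)
⊖-skewDecomposable {α} {β} pα pβ α≢[] β≢[] = α , β , pα , pβ , α≢[] , β≢[] , sym (inflate-21 α β)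

max∷-skewDecomposable : ∀ {m β} → β ↭ range 0 (suc m) → SkewDecomposable (suc m ∷ β)
max∷-skewDecomposable {m} {β} p =
  subst (λ M → SkewDecomposable (M ∷ β)) (≡.trans (↭-length p) (length-range 0 (suc m)))
    (⊖-skewDecomposable {0 ∷ []} refl (↭range⇒IsPerm-length p) (λ ()) (↭-range-nonEmpty p))

∷ʳmin-skewDecomposable : ∀ {m α} → α ↭ range 0 (suc m) → SkewDecomposable (map (_+ 1) α ++ [ 0 ])
∷ʳmin-skewDecomposable p = ⊖-skewDecomposable {β = 0 ∷ []} (↭range⇒IsPerm-length p) refl (↭-range-nonEmpty p) (λ ())

-- The four permutations of the theorem for n = 3 + j, in the order of claimed.
candidates : ℕ → List (List ℕ)
candidates j =
  (2 + j ∷ range 0 (2 + j)) ∷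
  (2 + j ∷ rangeSwapLast 0 j) ∷
  (range 1 (2 + j) ++ [ 0 ]) ∷
  (rangeSwapFirst 1 j ++ [ 0 ]) ∷ []

claimed≡candidates : ∀ i → claimed (3 + i) ≡ candidates i
claimed≡candidates i = cong₂ _∷_ first (cong₂ _∷_ second (cong₂ _∷_ third (cong [_] fourth)))
  where
  first : inflate p21 (p1 ∷ I (2 + i) ∷ []) ≡ 2 + i ∷ range 0 (2 + i)
  first = ≡.trans (inflate-21 p1 (I (2 + i))) (cong₂ _∷_ (length-upTo (2 + i)) (upTo≡range (2 + i)))
  second : inflate p312 (p1 ∷ I i ∷ p21 ∷ []) ≡ 2 + i ∷ rangeSwapLast 0 i
  second rewrite rangeSwapLast≡ 0 i | map-+-upTo 0 i
               | +-identityʳ (length (upTo i) + 2) | +-identityʳ (length (upTo i)) | +-identityʳ (length (upTo i))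
               | length-upTo i | +-comm i 2 | +-comm i 1 = refl
  third : inflate p21 (I (2 + i) ∷ p1 ∷ []) ≡ range 1 (2 + i) ++ [ 0 ]
  third = cong (_++ [ 0 ]) (map-+-upTo 1 (2 + i))
  fourth : inflate p231 (p21 ∷ I i ∷ p1 ∷ []) ≡ rangeSwapFirst 1 i ++ [ 0 ]
  fourth = cong (λ xs → 2 ∷ 1 ∷ xs ++ [ 0 ]) (map-+-upTo 3 i)

max∷-↭ : ∀ {m β} → β ↭ range 0 m → m ∷ β ↭ range 0 (suc m)
max∷-↭ {m} p = trans (prep m p) (range-↭-max∷ m)

∷ʳmin-↭ : ∀ {m A} → A ↭ range 1 m → A ++ [ 0 ] ↭ range 0 (suc m)
∷ʳmin-↭ {A = A} p = trans (↭-sym (∷↭∷ʳ 0 A)) (prep 0 p)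

candidates-↭ : ∀ j → All (_↭ range 0 (3 + j)) (candidates j)
candidates-↭ j = max∷-↭ refl ∷ max∷-↭ (rangeSwapLast-↭ 0 j) ∷ ∷ʳmin-↭ refl ∷ ∷ʳmin-↭ (rangeSwapFirst-↭ 1 j) ∷ []

candidates-unique : ∀ j → Unique (candidates (suc j))
candidates-unique j =
  ((λ eq → range≢rangeSwapLast 0 (suc j) (∷-injectiveʳ eq)) ∷ (λ ()) ∷ (λ ()) ∷ []) ∷
  ((λ ()) ∷ (λ ()) ∷ []) ∷ ((λ ()) ∷ []) ∷ [] ∷ []

candidate⇒skewAvoiding : ∀ j {π} → π ∈ candidates j → SkewDecomposable π × AvoidsAll π 𝒫
candidate⇒skewAvoiding j (here refl) =
  max∷-skewDecomposable refl ,
  startMinimal⇒avoids𝒫 (increasing⇒startMinimal (range-increasing 0 (2 + j)))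
candidate⇒skewAvoiding j (there (here refl)) =
  max∷-skewDecomposable (rangeSwapLast-↭ 0 j) ,
  startMinimal⇒avoids𝒫 (rangeSwapLast-startMinimal 0 j)
candidate⇒skewAvoiding j (there (there (here refl))) =
  subst (λ A → SkewDecomposable (A ++ [ 0 ])) (map-+-range 1 0 (2 + j)) (∷ʳmin-skewDecomposable {α = range 0 (2 + j)} refl) ,
  endMaximal⇒avoids𝒫 (increasing⇒endMaximal (range-increasing 1 (2 + j)))
candidate⇒skewAvoiding j (there (there (there (here refl)))) =
  subst (λ A → SkewDecomposable (2 ∷ 1 ∷ A ++ [ 0 ])) (map-+-range 1 2 j) (∷ʳmin-skewDecomposable (rangeSwapFirst-↭ 0 j)) ,
  endMaximal⇒avoids𝒫 (rangeSwapFirst-endMaximal 1 j)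

max∷-avoiding⇒candidate : ∀ j {M β} → M ≡ 2 + j → M ∷ β ↭ range 0 (3 + j) → AvoidsAll (M ∷ β) 𝒫 →
  M ∷ β ∈ candidates j
max∷-avoiding⇒candidate j {β = β} refl p av =
  classify (startMinimal-↭-range j β↭ (avoids𝒫⇒startMinimal (All.map proj₂ (↭-range⇒bounded β↭)) (↭-range⇒unique β↭) av))
  where
  β↭ : β ↭ range 0 (2 + j)
  β↭ = drop-∷ (trans p (↭-sym (range-↭-max∷ (2 + j))))
  classify : β ≡ range 0 (2 + j) ⊎ β ≡ rangeSwapLast 0 j → 2 + j ∷ β ∈ candidates j
  classify (inj₁ refl) = here refl
  classify (inj₂ refl) = there (here refl)

∷ʳmin-avoiding⇒candidate : ∀ j {A} → A ++ [ 0 ] ↭ range 0 (3 + j) → AvoidsAll (A ++ [ 0 ]) 𝒫 →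
  A ++ [ 0 ] ∈ candidates j
∷ʳmin-avoiding⇒candidate j {A} p av =
  classify (endMaximal-↭-range j A↭ (avoids𝒫⇒endMaximal (All.map proj₁ (↭-range⇒bounded A↭)) (↭-range⇒unique A↭) av))
  where
  A↭ : A ↭ range 1 (2 + j)
  A↭ = drop-∷ (trans (∷↭∷ʳ 0 A) p)
  classify : A ≡ range 1 (2 + j) ⊎ A ≡ rangeSwapFirst 1 j → A ++ [ 0 ] ∈ candidates j
  classify (inj₁ refl) = there (there (here refl))
  classify (inj₂ refl) = there (there (there (here refl)))

skewSum-avoiding⇒candidate : ∀ j α β → IsPerm (length α) α → IsPerm (length β) β → NonEmpty α → NonEmpty β →
  α ⊖ β ↭ range 0 (3 + j) → AvoidsAll (α ⊖ β) 𝒫 → α ⊖ β ∈ candidates j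
skewSum-avoiding⇒candidate j [] β _ _ α≢[] _ _ _ = contradiction refl α≢[]
skewSum-avoiding⇒candidate j α [] _ _ _ β≢[] _ _ = contradiction refl β≢[]
skewSum-avoiding⇒candidate j (a ∷ []) β pα _ _ _ p av with ↭-singleton-inv pα
... | refl = max∷-avoiding⇒candidate j (suc-injective (≡.trans (↭-length p) (length-range 0 (3 + j)))) p av
skewSum-avoiding⇒candidate j (x ∷ y ∷ as) (b ∷ []) _ pβ _ _ p av with ↭-singleton-inv pβ
... | refl = ∷ʳmin-avoiding⇒candidate j {map (_+ 1) (x ∷ y ∷ as)} p av
skewSum-avoiding⇒candidate j (x ∷ y ∷ as) (u ∷ v ∷ bs) pα pβ _ _ _ av
  with ↭-range⇒unique (IsPerm⇒↭range pα) | ↭-range⇒unique (IsPerm⇒↭range pβ) | ↭-range⇒bounded (IsPerm⇒↭range pβ)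
... | (x≢y ∷ _) ∷ _ | (u≢v ∷ _) ∷ _ | (_ , u<K) ∷ (_ , v<K) ∷ _ = ⊥-elim (¬avoids𝒫-⊖ x≢y u≢v u<K v<K av)

skewAvoiding⇒candidate : ∀ j {π} → π ↭ range 0 (3 + j) → SkewDecomposable π → AvoidsAll π 𝒫 → π ∈ candidates j
skewAvoiding⇒candidate j p (α , β , pα , pβ , α≢[] , β≢[] , π≡) av with ≡.trans π≡ (inflate-21 α β)
... | refl = skewSum-avoiding⇒candidate j α β pα pβ α≢[] β≢[] p av

mainTheorem12 : (n : ℕ) → 4 ≤ n →
    Unique (claimed n) × All (IsPerm n) (claimed n) ×
    ((π : List ℕ) → IsPerm n π →
      ((SkewDecomposable π × AvoidsAll π 𝒫) ⇔ (π ∈ claimed n)))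
mainTheorem12 .(4 + j) (s≤s (s≤s (s≤s (s≤s (z≤n {j}))))) rewrite claimed≡candidates (suc j) =
  candidates-unique j ,
  All.map ↭range⇒IsPerm (candidates-↭ (suc j)) ,
  λ π pπ → mk⇔ (λ (sd , av) → skewAvoiding⇒candidate (suc j) (IsPerm⇒↭range pπ) sd av)
               (candidate⇒skewAvoiding (suc j))
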